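{- Let $S$ be a string of length $n>1$ as described in the context and let $i\in\{0,\dots,n-1\}$. Then $\mathcal{P}_i=\emptyset$ if and only if $i=0$ or $S_{i-1}\prec S_i$. Furthermore, if $\mathcal{P}_i\neq\emptyset$ then $i-1\in\mathcal{P}_i$.
   Context: $S$ is a string of length $n>1$ over a totally ordered alphabet $\Sigma$, zero-indexed, with $S[n-1]=\$$ and $S[k]>\$$ for all $k<n-1$. $S_i=S[i]\cdots S[n-1]$ ($S_n$ is empty); $\prec$ is the lexicographic order on strings (a proper prefix is smaller). $\mathrm{nss}[j]=\min\{k\in\{j+1,\dots,n\}:S_k\prec S_j\}$ for $0\le j<n$, and $\mathcal{P}_i=\{j\in\{0,\dots,i-1\}:\mathrm{nss}[j]=i\}$. -}

module Defs where

open import Level using (Level)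
open import Data.Nat using (ℕ; zero; suc; _<_; _≤_)
open import Data.Fin using (Fin; toℕ; fromℕ)
open import Data.List using (List; drop; tabulate)
open import Data.Product using (_×_)
open import Relation.Nullary using (¬_)
open import Relation.Binary.Bundles using (StrictTotalOrder)
import Data.List.Relation.Binary.Lex.Strict as LexStrict

module StringDefs {a ℓ₁ ℓ₂ : Level} (Alph : StrictTotalOrder a ℓ₁ ℓ₂) where
  open StrictTotalOrder Alph public using (Carrier)
  open StrictTotalOrder Alph using () renaming (_<_ to _<ᶜ_; _≈_ to _≈ᶜ_)

  -- the lexicographic order ≺ on strings over the alphabet
  -- (standard strict lexicographic order: a proper prefix is smaller)
  _≺_ : List Carrier → List Carrier → Set _
  _≺_ = StrictTotalOrder._<_ (LexStrict.<-strictTotalOrder Alph)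

  -- A string S of length n is a function Fin n → Carrier (S[k] = S k).
  -- Suffix S_i = S[i] ⋯ S[n-1]; S_n is the empty string.
  suffix : {n : ℕ} → (Fin n → Carrier) → ℕ → List Carrier
  suffix S i = drop i (tabulate S)

  -- S (of length suc m, so S[n-1] = S (fromℕ m)) is terminated by the
  -- sentinel $: S[n-1] = $ and S[k] > $ for all k < n-1.
  Terminated : {m : ℕ} → (Fin (suc m) → Carrier) → Carrier → Set _
  Terminated {m} S $ =
    (S (fromℕ m) ≈ᶜ $) × ((k : Fin (suc m)) → toℕ k < m → $ <ᶜ S k)

  -- NssIs S j i  :⇔  nss[j] = i, i.e. i is the minimum of
  -- { k ∈ {j+1,…,n} : S_k ≺ S_j }.
  NssIs : {n : ℕ} → (Fin n → Carrier) → ℕ → ℕ → Set _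
  NssIs {n} S j i =
    (j < i × i ≤ n × suffix S i ≺ suffix S j)
    × ((k : ℕ) → j < k → k < i → ¬ (suffix S k ≺ suffix S j))

  _∈𝒫[_]_ : {n : ℕ} → ℕ → ℕ → (Fin n → Carrier) → Set _
  j ∈𝒫[ i ] S = j < i × NssIs S j i

{-# OPTIONS --safe #-}
-- Adjacent suffixes S_{i-1} and S_i have different lengths, so they are never
-- equal and exactly one of S_{i-1} ≺ S_i, S_i ≺ S_{i-1} holds. In the second case
-- i is the very next position after i-1, so nss[i-1] = i. In the first case no j
-- has nss[j] = i: for j = i-1 this is asymmetry, and for j < i-1 the suffix S_{i-1}
-- would already be smaller than S_j by transitivity, contradicting minimality.
module Submission where

open import Defs
open import Level using (Level; _⊔_)
open import Data.Nat using (ℕ; zero; suc; _<_; _≤_; _∸_)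
open import Data.Nat.Properties
  using (≤-refl; <⇒≤; <⇒≢; <⇒≱; n<1+n; ∸-cancelˡ-≡; m<1+n⇒m<n∨m≡n; m<1+n⇒m≤n)
open import Data.Product using (_×_; ∃-syntax; _,_)
open import Data.Sum as Sum using (_⊎_; inj₁; inj₂; [_,_])
open import Data.Fin using (Fin)
open import Data.List using (List; drop; length; tabulate)
open import Data.List.Properties using (length-drop; length-tabulate)
open import Data.List.Relation.Binary.Pointwise using (Pointwise; Pointwise-length)
open import Data.Empty using (⊥-elim)
open import Function using (id; _∘_)
open import Relation.Nullary using (¬_)
open import Relation.Binary.PropositionalEquality using (_≡_; refl; sym; trans; subst)
open import Relation.Binary.Bundles using (StrictTotalOrder)
open import Relation.Binary.Definitions using (tri<; tri≈; tri>)
open import Function.Bundles using (_⇔_; mk⇔)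
import Data.List.Relation.Binary.Lex.Strict as LexStrict

drop≉drop-suc : ∀ {a ℓ} {A : Set a} {R : A → A → Set ℓ} (p : ℕ) (xs : List A) →
                p < length xs → ¬ Pointwise R (drop p xs) (drop (suc p) xs)
drop≉drop-suc p xs p<len eq = <⇒≢ (n<1+n p) (∸-cancelˡ-≡ (<⇒≤ p<len) p<len lengths≡)
  where
  lengths≡ : length xs ∸ p ≡ length xs ∸ suc p
  lengths≡ = trans (sym (length-drop p xs))
                   (trans (Pointwise-length eq) (length-drop (suc p) xs))

module Suffixes {a ℓ₁ ℓ₂ : Level} (Alph : StrictTotalOrder a ℓ₁ ℓ₂)
                {n : ℕ} (S : Fin n → StrictTotalOrder.Carrier Alph) where
  open StringDefs Alph
  open StrictTotalOrder (LexStrict.<-strictTotalOrder Alph)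
    using (compare) renaming (trans to ≺-trans; asym to ≺-asym)

  adjacent-suffixes-compare : (p : ℕ) → suc p ≤ n →
    suffix S p ≺ suffix S (suc p) ⊎ suffix S (suc p) ≺ suffix S p
  adjacent-suffixes-compare p p<n with compare (suffix S p) (suffix S (suc p))
  ... | tri< asc _ _ = inj₁ asc
  ... | tri≈ _ eq _ =
    ⊥-elim (drop≉drop-suc p (tabulate S) (subst (p <_) (sym (length-tabulate S)) p<n) eq)
  ... | tri> _ _ desc = inj₂ desc

  AscentAt : ℕ → Set (a ⊔ ℓ₁ ⊔ ℓ₂)
  AscentAt i = (i ≡ 0) ⊎ (suffix S (i ∸ 1) ≺ suffix S i)

  pred∈𝒫 : (p : ℕ) → suc p ≤ n → suffix S (suc p) ≺ suffix S p → p ∈𝒫[ suc p ] S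
  pred∈𝒫 p p<n desc =
    ≤-refl , (≤-refl , p<n , desc) , λ k p<k k<1+p _ → <⇒≱ p<k (m<1+n⇒m≤n k<1+p)

  ascentAt⇒𝒫-empty : (i : ℕ) → AscentAt i → ¬ (∃[ j ] (j ∈𝒫[ i ] S))
  ascentAt⇒𝒫-empty zero _ (_ , () , _)
  ascentAt⇒𝒫-empty (suc p) (inj₂ asc) (j , j<1+p , (_ , _ , S₁₊ₚ≺Sⱼ) , minimal)
    with m<1+n⇒m<n∨m≡n j<1+p
  ... | inj₁ j<p = minimal p j<p ≤-refl (≺-trans asc S₁₊ₚ≺Sⱼ)
  ... | inj₂ refl = ≺-asym asc S₁₊ₚ≺Sⱼ

  ascentAt⊎pred∈𝒫 : (i : ℕ) → i ≤ n → AscentAt i ⊎ (i ∸ 1) ∈𝒫[ i ] S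
  ascentAt⊎pred∈𝒫 zero _ = inj₁ (inj₁ refl)
  ascentAt⊎pred∈𝒫 (suc p) p<n = Sum.map inj₂ (pred∈𝒫 p p<n) (adjacent-suffixes-compare p p<n)

lemma2 : {a ℓ₁ ℓ₂ : Level} (Alph : StrictTotalOrder a ℓ₁ ℓ₂)
    → let open StringDefs Alph in
    (m : ℕ) → 0 < m
    → (S : Fin (suc m) → Carrier) ($ : Carrier) → Terminated S $
    → (i : ℕ) → i < suc m
    → ((¬ (∃[ j ] (j ∈𝒫[ i ] S))) ⇔ ((i ≡ 0) ⊎ (suffix S (i ∸ 1) ≺ suffix S i)))
    × ((∃[ j ] (j ∈𝒫[ i ] S)) → (i ∸ 1) ∈𝒫[ i ] S)
lemma2 Alph m _ S $ _ i i<n =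
  mk⇔ (λ empty → [ id , ⊥-elim ∘ empty ∘ (i ∸ 1 ,_) ] (ascentAt⊎pred∈𝒫 i (<⇒≤ i<n)))
      (ascentAt⇒𝒫-empty i)
  , λ nonempty → [ (λ asc → ⊥-elim (ascentAt⇒𝒫-empty i asc nonempty)) , id ]
                   (ascentAt⊎pred∈𝒫 i (<⇒≤ i<n))
  where open Suffixes Alph S
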